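{- Let $\Gamma$ be a finite connected simple graph with a perfect matching $\mathcal{M} = \{e_i = \{\alpha_i,\beta_i\} : 1 \le i \le m\}$, $m \ge 2$, such that the setwise stabilizer of $\mathcal{M}$ in $\operatorname{Aut}(\Gamma)$ acts $2$-transitively on the edges of $\mathcal{M}$. If the induced subgraph $\Gamma[\alpha_1,\beta_1,\alpha_2,\beta_2]$ is isomorphic to $K_4$, then $\Gamma \cong K_{2m}$.
   Context: $\Gamma[X]$ denotes the subgraph induced on the vertex set $X$. -}

module Defs where

open import Level using (0ℓ)
open import Data.Nat using (ℕ; _≤_; _<_; _*_; s≤s; z≤n)
open import Data.Fin using (Fin; fromℕ<)
open import Data.Vec using (Vec; lookup; _∷_; [])
open import Data.Product using (Σ; ∃; _×_; _,_)
open import Data.Sum using (_⊎_)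
open import Relation.Nullary using (¬_)
open import Relation.Binary.PropositionalEquality using (_≡_; _≢_; refl) renaming (sym to ≡-sym)
open import Relation.Binary.Construct.Closure.ReflexiveTransitive using (Star)
open import Function.Bundles using (_↔_; _⇔_; Inverse)
open import Function.Definitions using (Injective)

record Graph (n : ℕ) : Set₁ where
  field
    Adj   : Fin n → Fin n → Set
    sym   : ∀ {u v} → Adj u v → Adj v u
    irrefl : ∀ {u} → ¬ Adj u u
open Graph public

Connected : ∀ {n} → Graph n → Set
Connected Γ = ∀ u v → Star (Adj Γ) u v

_≅_ : ∀ {n n'} → Graph n → Graph n' → Set
_≅_ {n} {n'} Γ Δ = Σ (Fin n ↔ Fin n') λ f →
  ∀ u v → (Adj Γ u v ⇔ Adj Δ (Inverse.to f u) (Inverse.to f v))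

K : (n : ℕ) → Graph n
K n = record { Adj = λ u v → u ≢ v ; sym = λ p q → p (≡-sym q) ; irrefl = λ p → p refl }

-- Induced subgraph Γ[X] on the vertices listed by f (used with f injective, X = image of f).
induced : ∀ {n k} (Γ : Graph n) (f : Fin k → Fin n) → Graph k
induced Γ f = record
  { Adj = λ i j → Adj Γ (f i) (f j)
  ; sym = sym Γ
  ; irrefl = irrefl Γ }

IsAut : ∀ {n} → Graph n → Fin n ↔ Fin n → Set
IsAut Γ σ = ∀ u v → (Adj Γ u v ⇔ Adj Γ (Inverse.to σ u) (Inverse.to σ v))

record PerfectMatching {n : ℕ} (Γ : Graph n) (m : ℕ) : Set where
  field
    α β      : Fin m → Fin n
    edge     : ∀ i → Adj Γ (α i) (β i)
    α-inj    : Injective _≡_ _≡_ α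
    β-inj    : Injective _≡_ _≡_ β
    αβ-disj  : ∀ i j → α i ≢ β j
    covers   : ∀ v → ∃ λ i → v ≡ α i ⊎ v ≡ β i
open PerfectMatching public

MapsEdge : ∀ {n m} {Γ : Graph n} → PerfectMatching Γ m → Fin n ↔ Fin n → Fin m → Fin m → Set
MapsEdge M σ i j =
  (Inverse.to σ (α M i) ≡ α M j × Inverse.to σ (β M i) ≡ β M j) ⊎
  (Inverse.to σ (α M i) ≡ β M j × Inverse.to σ (β M i) ≡ α M j)

Stabilizes : ∀ {n m} {Γ : Graph n} → PerfectMatching Γ m → Fin n ↔ Fin n → Set
Stabilizes M σ = ∀ i → ∃ λ j → MapsEdge M σ i j

StabTwoTransitive : ∀ {n m} (Γ : Graph n) → PerfectMatching Γ m → Set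
StabTwoTransitive Γ M = ∀ i j k l → i ≢ j → k ≢ l →
  Σ (_ ↔ _) λ σ → IsAut Γ σ × Stabilizes M σ × MapsEdge M σ i k × MapsEdge M σ j l

-- The four vertices α₁, β₁, α₂, β₂ (indices 0 and 1 in Fin m), with m ≥ 2.
fourVerts : ∀ {n m} {Γ : Graph n} → PerfectMatching Γ m → 2 ≤ m → Fin 4 → Fin n
fourVerts M (s≤s (s≤s _)) = lookup (α M Fin.zero ∷ β M Fin.zero ∷ α M (Fin.suc Fin.zero) ∷ β M (Fin.suc Fin.zero) ∷ [])
  where import Data.Fin as Fin

-- Any two vertices on distinct edges e_i, e_j of M are images, under an automorphism
-- sending e_1 to e_i and e_2 to e_j, of a vertex of e_1 and a vertex of e_2; these are
-- adjacent since Γ[α₁,β₁,α₂,β₂] ≅ K₄, hence so are the original two vertices. Vertices on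
-- the same edge of M are adjacent via that edge. So Γ is complete on its 2m vertices.
module Submission where

open import Defs
open import Data.Nat using (ℕ; _≤_; _*_; suc; s≤s)
open import Data.Nat.Properties using (+-identityʳ)
open import Data.Fin using (Fin; zero; suc; _≟_)
open import Data.Fin.Properties using (+↔⊎)
open import Data.Product using (∃; _×_; _,_)
open import Data.Sum using (_⊎_; inj₁; inj₂; [_,_])
open import Data.Empty using (⊥-elim)
open import Relation.Nullary using (yes; no)
open import Relation.Binary.PropositionalEquality
  using (_≡_; _≢_; refl; trans; cong; subst; subst₂)
  renaming (sym to ≡-sym)
open import Function.Bundles using (_↔_; Inverse; Injection; Equivalence; mk↔ₛ′; mk⇔)
open import Function.Properties.Inverse using (↔⇒↣)
open import Function.Construct.Composition using (_↔-∘_)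
open import Function.Construct.Symmetry using (↔-sym)

↔-injective : ∀ {A B : Set} (f : A ↔ B) {x y} → Inverse.to f x ≡ Inverse.to f y → x ≡ y
↔-injective f = Injection.injective (↔⇒↣ f)

2*m↔m⊎m : ∀ m → Fin (2 * m) ↔ (Fin m ⊎ Fin m)
2*m↔m⊎m m rewrite +-identityʳ m = +↔⊎

complete⇒≅K : ∀ {n k} (Γ : Graph n) → (∀ u v → u ≢ v → Adj Γ u v) → Fin n ↔ Fin k → Γ ≅ K k
complete⇒≅K Γ adj f = f , λ u v →
  mk⇔ (λ uv fu≡fv → irrefl Γ (subst (Adj Γ u) (≡-sym (↔-injective f fu≡fv)) uv))
      (λ fu≢fv → adj u v (λ u≡v → fu≢fv (cong (Inverse.to f) u≡v)))

induced≅K⇒adjacent : ∀ {n k} (Γ : Graph n) (f : Fin k → Fin n) → induced Γ f ≅ K k →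
  ∀ p q → p ≢ q → Adj Γ (f p) (f q)
induced≅K⇒adjacent Γ f (φ , adj⇔) p q p≢q =
  Equivalence.from (adj⇔ p q) (λ φp≡φq → p≢q (↔-injective φ φp≡φq))

module _ {n m : ℕ} {Γ : Graph n} (M : PerfectMatching Γ m) where

  OnEdge : Fin m → Fin n → Set
  OnEdge i u = u ≡ α M i ⊎ u ≡ β M i

  endpoint : Fin m ⊎ Fin m → Fin n
  endpoint = [ α M , β M ]

  endpointOf : Fin n → Fin m ⊎ Fin m
  endpointOf u with covers M u
  ... | i , inj₁ _ = inj₁ i
  ... | i , inj₂ _ = inj₂ i

  endpoint-endpointOf : ∀ u → endpoint (endpointOf u) ≡ u
  endpoint-endpointOf u with covers M u
  ... | i , inj₁ u≡αi = ≡-sym u≡αi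
  ... | i , inj₂ u≡βi = ≡-sym u≡βi

  endpointOf-endpoint : ∀ x → endpointOf (endpoint x) ≡ x
  endpointOf-endpoint (inj₁ i) with covers M (α M i)
  ... | j , inj₁ αi≡αj = cong inj₁ (≡-sym (α-inj M αi≡αj))
  ... | j , inj₂ αi≡βj = ⊥-elim (αβ-disj M i j αi≡βj)
  endpointOf-endpoint (inj₂ i) with covers M (β M i)
  ... | j , inj₁ βi≡αj = ⊥-elim (αβ-disj M j i (≡-sym βi≡αj))
  ... | j , inj₂ βi≡βj = cong inj₂ (≡-sym (β-inj M βi≡βj))

  vertices↔endpoints : Fin n ↔ (Fin m ⊎ Fin m)
  vertices↔endpoints = mk↔ₛ′ endpointOf endpoint endpointOf-endpoint endpoint-endpointOf

  sameEdge⇒adjacent : ∀ {i u v} → OnEdge i u → OnEdge i v → u ≢ v → Adj Γ u v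
  sameEdge⇒adjacent (inj₁ u≡αi) (inj₁ v≡αi) u≢v = ⊥-elim (u≢v (trans u≡αi (≡-sym v≡αi)))
  sameEdge⇒adjacent {i} (inj₁ u≡αi) (inj₂ v≡βi) _ =
    subst₂ (Adj Γ) (≡-sym u≡αi) (≡-sym v≡βi) (edge M i)
  sameEdge⇒adjacent {i} (inj₂ u≡βi) (inj₁ v≡αi) _ =
    subst₂ (Adj Γ) (≡-sym u≡βi) (≡-sym v≡αi) (Graph.sym Γ (edge M i))
  sameEdge⇒adjacent (inj₂ u≡βi) (inj₂ v≡βi) u≢v = ⊥-elim (u≢v (trans u≡βi (≡-sym v≡βi)))

  MapsEdge⇒onto : ∀ {σ k i u} → MapsEdge M σ k i → OnEdge i u →
    ∃ λ w → OnEdge k w × Inverse.to σ w ≡ u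
  MapsEdge⇒onto (inj₁ (σαk≡αi , _)) (inj₁ u≡αi) = _ , inj₁ refl , trans σαk≡αi (≡-sym u≡αi)
  MapsEdge⇒onto (inj₁ (_ , σβk≡βi)) (inj₂ u≡βi) = _ , inj₂ refl , trans σβk≡βi (≡-sym u≡βi)
  MapsEdge⇒onto (inj₂ (_ , σβk≡αi)) (inj₁ u≡αi) = _ , inj₂ refl , trans σβk≡αi (≡-sym u≡αi)
  MapsEdge⇒onto (inj₂ (σαk≡βi , _)) (inj₂ u≡βi) = _ , inj₁ refl , trans σαk≡βi (≡-sym u≡βi)

  twoTransitive⇒crossAdjacent : StabTwoTransitive Γ M → ∀ {k l} → k ≢ l →
    (∀ {w w'} → OnEdge k w → OnEdge l w' → Adj Γ w w') →
    ∀ {i j u v} → i ≢ j → OnEdge i u → OnEdge j v → Adj Γ u v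
  twoTransitive⇒crossAdjacent twoTrans {k} {l} k≢l adjₖₗ {i} {j} i≢j u∈eᵢ v∈eⱼ
    with twoTrans k l i j k≢l i≢j
  ... | σ , σ-aut , _ , eₖ↦eᵢ , eₗ↦eⱼ
    with MapsEdge⇒onto {σ} {k} {i} eₖ↦eᵢ u∈eᵢ | MapsEdge⇒onto {σ} {l} {j} eₗ↦eⱼ v∈eⱼ
  ... | w , w∈eₖ , σw≡u | w' , w'∈eₗ , σw'≡v =
    subst₂ (Adj Γ) σw≡u σw'≡v (Equivalence.to (σ-aut w w') (adjₖₗ w∈eₖ w'∈eₗ))

  twoTransitive⇒complete : StabTwoTransitive Γ M → ∀ {k l} → k ≢ l →
    (∀ {w w'} → OnEdge k w → OnEdge l w' → Adj Γ w w') →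
    ∀ u v → u ≢ v → Adj Γ u v
  twoTransitive⇒complete twoTrans k≢l adjₖₗ u v u≢v with covers M u | covers M v
  ... | i , u∈eᵢ | j , v∈eⱼ with i ≟ j
  ...   | yes refl = sameEdge⇒adjacent u∈eᵢ v∈eⱼ u≢v
  ...   | no i≢j = twoTransitive⇒crossAdjacent twoTrans k≢l adjₖₗ i≢j u∈eᵢ v∈eⱼ

module _ {n m : ℕ} {Γ : Graph n} (M : PerfectMatching Γ (suc (suc m))) where

  fourVerts≅K4⇒edges₁₂-adjacent : (m≥2 : 2 ≤ suc (suc m)) → induced Γ (fourVerts M m≥2) ≅ K 4 →
    ∀ {w w'} → OnEdge M zero w → OnEdge M (suc zero) w' → Adj Γ w w'
  fourVerts≅K4⇒edges₁₂-adjacent m≥2@(s≤s (s≤s _)) iso {w} {w'} w∈e₁ w'∈e₂ =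
    subst₂ (Adj Γ) (≡-sym (index₁ w∈e₁)) (≡-sym (index₂ w'∈e₂))
      (induced≅K⇒adjacent Γ (fourVerts M m≥2) iso (slot₁ w∈e₁) (slot₂ w'∈e₂)
        (slots-distinct w∈e₁ w'∈e₂))
    where
    slot₁ : OnEdge M zero w → Fin 4
    slot₁ (inj₁ _) = zero
    slot₁ (inj₂ _) = suc zero

    slot₂ : OnEdge M (suc zero) w' → Fin 4
    slot₂ (inj₁ _) = suc (suc zero)
    slot₂ (inj₂ _) = suc (suc (suc zero))

    index₁ : (w∈e₁ : OnEdge M zero w) → w ≡ fourVerts M m≥2 (slot₁ w∈e₁)
    index₁ (inj₁ w≡α₁) = w≡α₁
    index₁ (inj₂ w≡β₁) = w≡β₁

    index₂ : (w'∈e₂ : OnEdge M (suc zero) w') → w' ≡ fourVerts M m≥2 (slot₂ w'∈e₂)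
    index₂ (inj₁ w'≡α₂) = w'≡α₂
    index₂ (inj₂ w'≡β₂) = w'≡β₂

    slots-distinct : ∀ w∈e₁ w'∈e₂ → slot₁ w∈e₁ ≢ slot₂ w'∈e₂
    slots-distinct (inj₁ _) (inj₁ _) ()
    slots-distinct (inj₁ _) (inj₂ _) ()
    slots-distinct (inj₂ _) (inj₁ _) ()
    slots-distinct (inj₂ _) (inj₂ _) ()

lemma6p4 : (n m : ℕ) (Γ : Graph n) (M : PerfectMatching Γ m) (m≥2 : 2 ≤ m) →
    Connected Γ →
    StabTwoTransitive Γ M →
    induced Γ (fourVerts M m≥2) ≅ K 4 →
    Γ ≅ K (2 * m)
lemma6p4 n m Γ M m≥2@(s≤s (s≤s _)) _ twoTrans four≅K4 =
  complete⇒≅K Γ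
    (twoTransitive⇒complete M twoTrans {zero} {suc zero} (λ ())
      (fourVerts≅K4⇒edges₁₂-adjacent M m≥2 four≅K4))
    (↔-sym (2*m↔m⊎m m) ↔-∘ vertices↔endpoints M)
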